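{- Let $G$ be a graph, $S\subseteq V(G)$ and $M>1$. Let $t_1,t_2\in\mathbb N$ and let $v_1,v_2\in V(G)$ be such that $v_2\notin W^S_{t_1+1}(v_1;M)$ and $3\cdot4^{t_1}d^S_G(v_1)\geq4^{t_2}d^S_G(v_2)$. Then $W^S_{t_1}(v_1;M)\cap W^S_{t_2}(v_2;M)=\emptyset$.
   Context: $N^S_G(u)=N_G(u)\cap S$, $d^S_G(u)=|N^S_G(u)|$. For $M>1$ and $t\in\mathbb N\cup\{0\}$, the $(M,t)$-cluster neighbourhood of $v$ to $S$ is $W^S_t(v;M)=\{u\in V(G):|N^S_G(u)\triangle N^S_G(v)|\leq(4^t/M)\cdot|N^S_G(v)|\}$.
   Formalization: The parameter M ranges over the rationals greater than 1. -}

module Defs where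

open import Data.Nat using (ℕ; _^_)
open import Data.Fin using (Fin)
open import Data.Fin.Subset using (Subset; _∩_; _∪_; ∁; ∣_∣; _∈_)
open import Data.Vec using (tabulate)
open import Data.Bool using (Bool; true; false)
open import Data.Integer using (+_)
open import Data.Rational using (ℚ; _≤_; _*_; _/_)
open import Relation.Binary.PropositionalEquality using (_≡_)
open import Relation.Nullary using (¬_)

record Graph (n : ℕ) : Set where
  field
    adj   : Fin n → Fin n → Bool
    sym   : ∀ u v → adj u v ≡ adj v u
    irrefl : ∀ v → adj v v ≡ false

open Graph public

N : ∀ {n} → Graph n → Fin n → Subset n
N G u = tabulate (λ w → adj G u w)

NS : ∀ {n} → Graph n → Subset n → Fin n → Subset n
NS G S u = N G u ∩ S

dS : ∀ {n} → Graph n → Subset n → Fin n → ℕ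
dS G S u = ∣ NS G S u ∣

_△_ : ∀ {n} → Subset n → Subset n → Subset n
A △ B = (A ∩ ∁ B) ∪ (B ∩ ∁ A)

ℕ→ℚ : ℕ → ℚ
ℕ→ℚ k = (+ k) / 1

-- u ∈ W^S_t(v;M)  ⟺  |N^S(u) △ N^S(v)| ≤ (4^t / M) · |N^S(v)|,
-- stated multiplied through by M > 0:  M · |Δ| ≤ 4^t · d^S(v).
InW : ∀ {n} → Graph n → Subset n → ℕ → ℚ → Fin n → Fin n → Set
InW G S t M v u =
  M * ℕ→ℚ ∣ NS G S u △ NS G S v ∣ ≤ ℕ→ℚ (4 ^ t) * ℕ→ℚ (dS G S v)

{-# OPTIONS --safe #-}
module Submission where

-- |N(u) △ N(v)| is a metric on neighbourhoods.  A common vertex u of both clusters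
-- gives, by the triangle inequality through N(u),
--   M |N(v₁) △ N(v₂)| ≤ 4^t₂ d(v₂) + 4^t₁ d(v₁) ≤ 3·4^t₁ d(v₁) + 4^t₁ d(v₁) = 4^(t₁+1) d(v₁),
-- i.e. v₂ ∈ W_(t₁+1)(v₁), contrary to the hypothesis.

open import Defs
open import Data.Bool using (true; false)
open import Data.Vec using ([]; _∷_)
open import Data.Nat using (ℕ; suc; _+_; _^_; s≤s; z≤n)
  renaming (_*_ to _*ℕ_; _≤_ to _≤ℕ_; _<_ to _<ℕ_)
import Data.Nat.Properties as ℕ
open import Data.Nat.Coprimality using (1-coprimeTo) renaming (sym to coprime-sym)
open import Data.Integer using (+_; +≤+)
import Data.Integer.Properties as ℤ
open import Data.Rational using (ℚ; 1ℚ; _<_)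
import Data.Rational as ℚ
import Data.Rational.Properties as ℚ
open import Data.Fin using (Fin)
open import Data.Fin.Subset using (Subset; ∣_∣)
open import Data.Product using (_×_; _,_)
open import Relation.Nullary using (¬_)
open import Relation.Binary.PropositionalEquality using (_≡_; refl; cong; cong₂; subst)
import Relation.Binary.PropositionalEquality as ≡

∣△∣-comm : ∀ {n} (A B : Subset n) → ∣ A △ B ∣ ≡ ∣ B △ A ∣
∣△∣-comm []          []          = refl
∣△∣-comm (true  ∷ A) (true  ∷ B) = ∣△∣-comm A B
∣△∣-comm (true  ∷ A) (false ∷ B) = cong suc (∣△∣-comm A B)
∣△∣-comm (false ∷ A) (true  ∷ B) = cong suc (∣△∣-comm A B)
∣△∣-comm (false ∷ A) (false ∷ B) = ∣△∣-comm A B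

x≤y+z⇒1+x≤y+[1+z] : ∀ {x} y z → x ≤ℕ y + z → suc x ≤ℕ y + suc z
x≤y+z⇒1+x≤y+[1+z] y z x≤y+z = ℕ.≤-trans (s≤s x≤y+z) (ℕ.≤-reflexive (≡.sym (ℕ.+-suc y z)))

x≤y+z⇒x≤1+y+[1+z] : ∀ {x} y z → x ≤ℕ y + z → x ≤ℕ suc (y + suc z)
x≤y+z⇒x≤1+y+[1+z] y z x≤y+z = ℕ.m≤n⇒m≤1+n (ℕ.≤-trans x≤y+z (ℕ.+-monoʳ-≤ y (ℕ.n≤1+n z)))

∣△∣-triangle : ∀ {n} (A B C : Subset n) → ∣ A △ C ∣ ≤ℕ ∣ A △ B ∣ + ∣ B △ C ∣
∣△∣-triangle []          []          []          = z≤n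
∣△∣-triangle (true  ∷ A) (true  ∷ B) (true  ∷ C) = ∣△∣-triangle A B C
∣△∣-triangle (true  ∷ A) (true  ∷ B) (false ∷ C) = x≤y+z⇒1+x≤y+[1+z] _ _ (∣△∣-triangle A B C)
∣△∣-triangle (true  ∷ A) (false ∷ B) (true  ∷ C) = x≤y+z⇒x≤1+y+[1+z] _ _ (∣△∣-triangle A B C)
∣△∣-triangle (true  ∷ A) (false ∷ B) (false ∷ C) = s≤s (∣△∣-triangle A B C)
∣△∣-triangle (false ∷ A) (true  ∷ B) (true  ∷ C) = s≤s (∣△∣-triangle A B C)
∣△∣-triangle (false ∷ A) (true  ∷ B) (false ∷ C) = x≤y+z⇒x≤1+y+[1+z] _ _ (∣△∣-triangle A B C)
∣△∣-triangle (false ∷ A) (false ∷ B) (true  ∷ C) = x≤y+z⇒1+x≤y+[1+z] _ _ (∣△∣-triangle A B C)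
∣△∣-triangle (false ∷ A) (false ∷ B) (false ∷ C) = ∣△∣-triangle A B C

ℕ→ℚ≡mkℚ : ∀ k → ℕ→ℚ k ≡ ℚ.mkℚ (+ k) 0 (coprime-sym (1-coprimeTo k))
ℕ→ℚ≡mkℚ k = ℚ.normalize-coprime (coprime-sym (1-coprimeTo k))

ℕ→ℚ-mono-≤ : ∀ {a b} → a ≤ℕ b → ℕ→ℚ a ℚ.≤ ℕ→ℚ b
ℕ→ℚ-mono-≤ {a} {b} a≤b rewrite ℕ→ℚ≡mkℚ a | ℕ→ℚ≡mkℚ b =
  ℚ.*≤* (ℤ.*-monoʳ-≤-nonNeg (+ 1) (+≤+ a≤b))

ℕ→ℚ-homo-+ : ∀ a b → ℕ→ℚ (a + b) ≡ ℕ→ℚ a ℚ.+ ℕ→ℚ b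
ℕ→ℚ-homo-+ a b rewrite ℕ→ℚ≡mkℚ a | ℕ→ℚ≡mkℚ b
  | ℤ.*-identityʳ (+ a) | ℤ.*-identityʳ (+ b) | ≡.sym (ℤ.pos-+ a b) = refl

ℕ→ℚ-homo-* : ∀ a b → ℕ→ℚ (a *ℕ b) ≡ ℕ→ℚ a ℚ.* ℕ→ℚ b
ℕ→ℚ-homo-* a b rewrite ℕ→ℚ≡mkℚ a | ℕ→ℚ≡mkℚ b | ≡.sym (ℤ.pos-* a b) = refl

InW-triangle : ∀ {n} (G : Graph n) (S : Subset n) (M : ℚ) .{{_ : ℚ.NonNegative M}}
  (t₁ t₂ : ℕ) {v₁ v₂ u : Fin n} → InW G S t₁ M v₁ u → InW G S t₂ M v₂ u →
  M ℚ.* ℕ→ℚ ∣ NS G S v₂ △ NS G S v₁ ∣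
    ℚ.≤ ℕ→ℚ (4 ^ t₂ *ℕ dS G S v₂ + 4 ^ t₁ *ℕ dS G S v₁)
InW-triangle {n} G S M t₁ t₂ {v₁} {v₂} {u} u∈W₁ u∈W₂ = begin
  M ℚ.* X ∣ A₂ △ A₁ ∣                         ≤⟨ ℚ.*-monoˡ-≤-nonNeg M (ℕ→ℚ-mono-≤ A₂A₁≤BA₂+BA₁) ⟩
  M ℚ.* X (∣ B △ A₂ ∣ + ∣ B △ A₁ ∣)           ≡⟨ cong (M ℚ.*_) (ℕ→ℚ-homo-+ ∣ B △ A₂ ∣ ∣ B △ A₁ ∣) ⟩
  M ℚ.* (X ∣ B △ A₂ ∣ ℚ.+ X ∣ B △ A₁ ∣)       ≡⟨ ℚ.*-distribˡ-+ M _ _ ⟩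
  M ℚ.* X ∣ B △ A₂ ∣ ℚ.+ M ℚ.* X ∣ B △ A₁ ∣   ≤⟨ ℚ.+-mono-≤ u∈W₂ u∈W₁ ⟩
  X (4 ^ t₂) ℚ.* X d₂ ℚ.+ X (4 ^ t₁) ℚ.* X d₁ ≡⟨ cong₂ ℚ._+_ (ℕ→ℚ-homo-* (4 ^ t₂) d₂) (ℕ→ℚ-homo-* (4 ^ t₁) d₁) ⟨
  X (4 ^ t₂ *ℕ d₂) ℚ.+ X (4 ^ t₁ *ℕ d₁)       ≡⟨ ℕ→ℚ-homo-+ (4 ^ t₂ *ℕ d₂) (4 ^ t₁ *ℕ d₁) ⟨
  X (4 ^ t₂ *ℕ d₂ + 4 ^ t₁ *ℕ d₁)             ∎
  where
  open ℚ.≤-Reasoning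
  X : ℕ → ℚ
  X = ℕ→ℚ
  A₁ A₂ B : Subset n
  A₁ = NS G S v₁
  A₂ = NS G S v₂
  B  = NS G S u
  d₁ d₂ : ℕ
  d₁ = dS G S v₁
  d₂ = dS G S v₂
  A₂A₁≤BA₂+BA₁ : ∣ A₂ △ A₁ ∣ ≤ℕ ∣ B △ A₂ ∣ + ∣ B △ A₁ ∣
  A₂A₁≤BA₂+BA₁ = subst (λ k → ∣ A₂ △ A₁ ∣ ≤ℕ k + ∣ B △ A₁ ∣) (∣△∣-comm A₂ B) (∣△∣-triangle A₂ B A₁)

x≤3ab⇒x+ab≤4ab : ∀ {x} a b → x ≤ℕ 3 *ℕ a *ℕ b → x + a *ℕ b ≤ℕ 4 *ℕ a *ℕ b
x≤3ab⇒x+ab≤4ab {x} a b x≤3ab = begin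
  x + a *ℕ b             ≤⟨ ℕ.+-monoˡ-≤ (a *ℕ b) x≤3ab ⟩
  3 *ℕ a *ℕ b + a *ℕ b   ≡⟨ ℕ.+-comm (3 *ℕ a *ℕ b) (a *ℕ b) ⟩
  a *ℕ b + 3 *ℕ a *ℕ b   ≡⟨ ℕ.*-distribʳ-+ b a (3 *ℕ a) ⟨
  4 *ℕ a *ℕ b            ∎
  where open ℕ.≤-Reasoning

lemma4p4 : ∀ {n} (G : Graph n) (S : Subset n) (M : ℚ) → 1ℚ < M →
    (t₁ t₂ : ℕ) → 0 <ℕ t₁ → 0 <ℕ t₂ → (v₁ v₂ : Fin n) →
    ¬ InW G S (suc t₁) M v₁ v₂ →
    4 ^ t₂ *ℕ dS G S v₂ ≤ℕ 3 *ℕ 4 ^ t₁ *ℕ dS G S v₁ →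
    ∀ (u : Fin n) → ¬ (InW G S t₁ M v₁ u × InW G S t₂ M v₂ u)
lemma4p4 G S M 1<M t₁ t₂ _ _ v₁ v₂ v₂∉W₁₊₁ degree-bound u (u∈W₁ , u∈W₂) = v₂∉W₁₊₁ (begin
  M ℚ.* ℕ→ℚ ∣ NS G S v₂ △ NS G S v₁ ∣                   ≤⟨ InW-triangle G S M t₁ t₂ u∈W₁ u∈W₂ ⟩
  ℕ→ℚ (4 ^ t₂ *ℕ dS G S v₂ + 4 ^ t₁ *ℕ dS G S v₁)      ≤⟨ ℕ→ℚ-mono-≤ (x≤3ab⇒x+ab≤4ab (4 ^ t₁) (dS G S v₁) degree-bound) ⟩
  ℕ→ℚ (4 ^ suc t₁ *ℕ dS G S v₁)                         ≡⟨ ℕ→ℚ-homo-* (4 ^ suc t₁) (dS G S v₁) ⟩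
  ℕ→ℚ (4 ^ suc t₁) ℚ.* ℕ→ℚ (dS G S v₁)                  ∎)
  where
  open ℚ.≤-Reasoning
  instance
    M-nonNeg : ℚ.NonNegative M
    M-nonNeg = ℚ.nonNegative (ℚ.<⇒≤ (ℚ.<-trans (ℚ.positive⁻¹ 1ℚ) 1<M))
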